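{- Let $D=(G,\mathcal{O},w)$ be a weighted oriented graph such that for every $(y,x)\in E(D)$ with $y\in V^{+}$ there is $y'\in N_D(x)\setminus\{y\}$ with $N_D(y')\subseteq N_D^{+}(y)$. Then $L_3(\mathcal{C})=\emptyset$ for every strong vertex cover $\mathcal{C}$ of $D$.
   Context: A weighted oriented graph is a triple $D=(G,\mathcal{O},w)$ with $G$ a finite simple graph, $\mathcal{O}$ an orientation of its edges, $w:V(G)\to\mathbb{N}$; $E(D)$ is the set of oriented edges. $V^{+}=\{x\mid w(x)>1\}$. $N_D^{+}(x)=\{y\mid(x,y)\in E(D)\}$, $N_D^{ - }(x)=\{y\mid(y,x)\in E(D)\}$, $N_D(x)=N_D^+(x)\cup N_D^-(x)$. Standing convention: every source (vertex with $N_D^-(x)=\emptyset$) has weight $1$. A vertex cover of $D$ is a set of vertices meeting every edge. For a vertex cover $\mathcal{C}$: $L_1(\mathcal{C})=\{x\in\mathcal{C}\mid N_D^+(x)\setminus\mathcal{C}\ne\emptyset\}$, $L_2(\mathcal{C})=\{x\in\mathcal{C}\setminus L_1(\mathcal{C})\mid N_D^-(x)\setminus\mathcal{C}\ne\emptyset\}$, $L_3(\mathcal{C})=\mathcal{C}\setminus(L_1(\mathcal{C})\cup L_2(\mathcal{C}))$. $\mathcal{C}$ is strong if for every $x\in L_3(\mathcal{C})$ there is $(y,x)\in E(D)$ with $y\in(\mathcal{C}\setminus L_1(\mathcal{C}))\cap V^+$. -}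

module Defs where

open import Data.Nat using (ℕ; _≤_; _<_)
open import Data.Fin using (Fin)
open import Data.Fin.Subset using (Subset; _∈_; _∉_)
open import Data.Product using (Σ; ∃; _×_; _,_)
open import Data.Sum using (_⊎_)
open import Relation.Nullary using (¬_)
open import Relation.Binary.PropositionalEquality using (_≡_; _≢_)

-- A weighted oriented graph on vertex set Fin n.
-- arc x y means (x , y) ∈ E(D).
-- Weights take values in ℕ = {1,2,...}, i.e. w x ≥ 1, and every source
-- (vertex with no in-neighbour) has weight 1.
record WOG (n : ℕ) : Set₁ where
  field
    arc       : Fin n → Fin n → Set
    irrefl    : ∀ x → ¬ arc x x
    oriented  : ∀ x y → arc x y → ¬ arc y x
    w         : Fin n → ℕ
    w-pos     : ∀ x → 1 ≤ w x
    source-w1 : ∀ x → (∀ y → ¬ arc y x) → w x ≡ 1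

  InV+ : Fin n → Set
  InV+ x = 1 < w x

  Out : Fin n → Fin n → Set
  Out x y = arc x y
  In : Fin n → Fin n → Set
  In x y = arc y x
  Nbr : Fin n → Fin n → Set
  Nbr x y = arc x y ⊎ arc y x

  IsVertexCover : Subset n → Set
  IsVertexCover C = ∀ x y → arc x y → (x ∈ C) ⊎ (y ∈ C)

  L₁ : Subset n → Fin n → Set
  L₁ C x = x ∈ C × ∃ λ y → arc x y × y ∉ C

  L₂ : Subset n → Fin n → Set
  L₂ C x = x ∈ C × ¬ L₁ C x × ∃ λ y → arc y x × y ∉ C

  L₃ : Subset n → Fin n → Set
  L₃ C x = x ∈ C × ¬ L₁ C x × ¬ L₂ C x

  IsStrong : Subset n → Set
  IsStrong C = ∀ x → L₃ C x →
    ∃ λ y → arc y x × y ∈ C × ¬ L₁ C y × InV+ y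

  Hyp51 : Set
  Hyp51 = ∀ y x → arc y x → InV+ y →
    ∃ λ y' → Nbr x y' × y' ≢ y × (∀ z → Nbr y' z → arc y z)

-- Let x ∈ L₃(C) and let y be the in-neighbour of x given by strongness. Since
-- y ∉ L₁(C), every out-neighbour of y lies in C; the hypothesis yields a
-- neighbour y' of x with N(y') ⊆ N⁺(y), so N(y') ⊆ C and y' ∈ L₃(C) as well.
-- Strongness at y' gives an in-neighbour y₂ ∈ V⁺ of y', and the hypothesis
-- applied to (y₂, y') gives y₃ ∈ N(y') with N(y₃) ⊆ N⁺(y₂). Then y → y₂
-- (as y₂ ∈ N(y')) and y → y₃, so y ∈ N(y₃) and y₂ → y: an edge oriented
-- both ways.
module Submission where

open import Defs
open import Data.Fin using (Fin)
open import Data.Fin.Subset using (Subset; _∈_)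
open import Data.Fin.Subset.Properties using (_∈?_)
open import Data.Product using (_,_)
open import Data.Sum using (inj₁; inj₂)
open import Relation.Nullary using (¬_)
open import Relation.Nullary.Decidable using (decidable-stable)

module _ {n} (D : WOG n) where
  open WOG D

  ¬L₁⇒out⊆ : ∀ {C x z} → x ∈ C → ¬ L₁ C x → arc x z → z ∈ C
  ¬L₁⇒out⊆ {C} {x} {z} x∈C x∉L₁ x→z =
    decidable-stable (z ∈? C) λ z∉C → x∉L₁ (x∈C , z , x→z , z∉C)

  L₃⇒nbr⊆ : ∀ {C x z} → L₃ C x → Nbr x z → z ∈ C
  L₃⇒nbr⊆ (x∈C , x∉L₁ , _) (inj₁ x→z) = ¬L₁⇒out⊆ x∈C x∉L₁ x→z
  L₃⇒nbr⊆ {C} {x} {z} (x∈C , x∉L₁ , x∉L₂) (inj₂ z→x) =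
    decidable-stable (z ∈? C) λ z∉C → x∉L₂ (x∈C , x∉L₁ , z , z→x , z∉C)

  nbr⊆⇒L₃ : ∀ {C x} → x ∈ C → (∀ z → Nbr x z → z ∈ C) → L₃ C x
  nbr⊆⇒L₃ x∈C N⊆C =
      x∈C
    , (λ { (_ , z , x→z , z∉C) → z∉C (N⊆C z (inj₁ x→z)) })
    , (λ { (_ , _ , z , z→x , z∉C) → z∉C (N⊆C z (inj₂ z→x)) })

  dominated⇒L₃ : ∀ {C y y'} → y ∈ C → ¬ L₁ C y → y' ∈ C →
                 (∀ z → Nbr y' z → arc y z) → L₃ C y'
  dominated⇒L₃ y∈C y∉L₁ y'∈C N⊆N⁺ =
    nbr⊆⇒L₃ y'∈C λ z y'~z → ¬L₁⇒out⊆ y∈C y∉L₁ (N⊆N⁺ z y'~z)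

  dominated⇒¬heavy-in-neighbour : Hyp51 → ∀ {y y' y₂} →
    (∀ z → Nbr y' z → arc y z) → arc y₂ y' → ¬ InV+ y₂
  dominated⇒¬heavy-in-neighbour hyp {y} {y'} {y₂} N⊆N⁺ y₂→y' y₂∈V⁺
    with hyp y₂ y' y₂→y' y₂∈V⁺
  ... | y₃ , y'~y₃ , _ , N₃⊆N⁺₂ =
    oriented y y₂ (N⊆N⁺ y₂ (inj₂ y₂→y')) (N₃⊆N⁺₂ y (inj₂ (N⊆N⁺ y₃ y'~y₃)))

proposition5p1 : ∀ {n} (D : WOG n) → WOG.Hyp51 D →
    ∀ (C : Subset n) → WOG.IsVertexCover D C → WOG.IsStrong D C →
    ∀ (x : Fin n) → ¬ WOG.L₃ D C x
proposition5p1 D hyp C _ strong x x∈L₃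
  with strong x x∈L₃
... | y , y→x , y∈C , y∉L₁ , y∈V⁺
  with hyp y x y→x y∈V⁺
... | y' , x~y' , _ , N⊆N⁺
  with strong y' (dominated⇒L₃ D y∈C y∉L₁ (L₃⇒nbr⊆ D x∈L₃ x~y') N⊆N⁺)
... | y₂ , y₂→y' , _ , _ , y₂∈V⁺ =
  dominated⇒¬heavy-in-neighbour D hyp N⊆N⁺ y₂→y' y₂∈V⁺
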